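{- Let $2\le k<g$ be integers. A two-digit $(g,k)$ reverse multiple exists if and only if $k+1\le\gcd(g-k,k^2-1)$.
   Context: For integers $c_i$, $(c_{n-1},\dots,c_1,c_0)_g$ denotes $\sum_{i=0}^{n-1}c_ig^i$. A $(g,k)$ reverse multiple is a positive integer $N=(a_{n-1},\dots,a_1,a_0)_g$ with integers $0\le a_i\le g-1$ and $a_{n-1}\ne0$ such that $kN=(a_0,a_1,\dots,a_{n-1})_g$; it has $n$ digits. -}

module Defs where

open import Data.Nat using (ℕ; zero; suc; _+_; _*_; _<_)
open import Data.Vec using (Vec; []; _∷_; reverse; head)
open import Data.Vec.Relation.Unary.All using (All)
open import Data.Product using (_×_)
open import Relation.Binary.PropositionalEquality using (_≡_; _≢_)

-- Value of a digit vector listed from most significant to least significant: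
-- value g (c_{n-1} ∷ … ∷ c_0 ∷ []) = Σ c_i g^i   (Horner evaluation).
value : ∀ {n} → ℕ → Vec ℕ n → ℕ
value g ds = go 0 ds
  where
  go : ∀ {m} → ℕ → Vec ℕ m → ℕ
  go acc []       = acc
  go acc (d ∷ ds) = go (acc * g + d) ds

IsReverseMultiple : ℕ → ℕ → (n : ℕ) → Vec ℕ (suc n) → Set
IsReverseMultiple g k n ds =
  All (_< g) ds × head ds ≢ 0 × k * value g ds ≡ value g (reverse ds)

module Submission where

-- Write N = (a, b)_g = a * g + b and put d = g - k, K = k^2 - 1 and
-- L = k * g - 1 = k * d + K.  Cancelling a + k * b from both sides shows
-- that k * N = (b, a)_g is equivalent to the linear relation b * d = a * L.
-- Since L ≡ K (mod d), the gcd in the statement is e = gcd(d, L); write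
-- d = d' * e and L = M * e with d', M coprime.
--   (⇒) From b * d' = a * M we get M ∣ b, so M ≤ b < g; then
--       k * g = 1 + M * e together with e ≤ k would force k ≤ 1.
--   (⇐) If k < e, the digits (a, b) = (d', M) satisfy b * d = a * L, and
--       M < g because M * e < k * g ≤ e * g.

open import Defs
open import Data.Nat using (ℕ; suc; _+_; _*_; _∸_; _≤_; _<_; s≤s; z≤n; ≢-nonZero; >-nonZero)
open import Data.Nat.Properties
open import Data.Nat.GCD using (gcd; gcd[m,n]∣m; gcd[m,n]∣n; gcd[m,n]≡0⇒n≡0; gcd-greatest; c*gcd[m,n]≡gcd[cm,cn])
open import Data.Nat.Divisibility using (_∣_; divides; ∣-antisym; ∣m∣n⇒∣m+n; ∣m+n∣m⇒∣n; ∣n⇒∣m*n; ∣⇒≤)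
open import Data.Nat.Coprimality using (Coprime; coprime-divisor; gcd≡1⇒coprime)
import Data.Nat.Coprimality as Coprime
open import Data.Nat.Tactic.RingSolver using (solve-∀)
open import Data.Vec using (Vec; []; _∷_)
open import Data.Vec.Relation.Unary.All using ([]; _∷_)
open import Data.Product using (Σ; _,_)
open import Data.Sum using (inj₁; inj₂)
open import Function.Bundles using (_⇔_; mk⇔; Equivalence)
open import Relation.Binary.PropositionalEquality using (_≡_; _≢_; sym; trans; cong; cong₂; subst; module ≡-Reasoning)

-- For a two-digit number (a, b)_g with g = k + d and k * g = 1 + L, being a
-- (g,k) reverse multiple is the linear relation b * d = a * L: both sides
-- of k * (a g + b) = b g + a exceed a + k * b by a * L resp. b * d.
reverse-relation : ∀ {g k d L} a b → g ≡ k + d → k * g ≡ suc L →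
  (k * (a * g + b) ≡ b * g + a) ⇔ (b * d ≡ a * L)
reverse-relation {g} {k} {d} {L} a b g≡k+d kg≡1+L =
  mk⇔ (λ eq → +-cancelˡ-≡ (a + k * b) _ _ (trans (sym rhs) (trans (sym eq) lhs)))
      (λ eq → trans lhs (trans (cong (a + k * b +_) (sym eq)) (sym rhs)))
  where
  open ≡-Reasoning
  lhs : k * (a * g + b) ≡ a + k * b + a * L
  lhs = begin
    k * (a * g + b)     ≡⟨ distribute k a g b ⟩
    a * (k * g) + k * b ≡⟨ cong (λ x → a * x + k * b) kg≡1+L ⟩
    a * suc L + k * b   ≡⟨ regroup a L k b ⟩
    a + k * b + a * L   ∎
    where
    distribute : ∀ k a g b → k * (a * g + b) ≡ a * (k * g) + k * b
    distribute = solve-∀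
    regroup : ∀ a L k b → a * suc L + k * b ≡ a + k * b + a * L
    regroup = solve-∀
  rhs : b * g + a ≡ a + k * b + b * d
  rhs = begin
    b * g + a         ≡⟨ cong (λ x → b * x + a) g≡k+d ⟩
    b * (k + d) + a   ≡⟨ regroup b k d a ⟩
    a + k * b + b * d ∎
    where
    regroup : ∀ b k d a → b * (k + d) + a ≡ a + k * b + b * d
    regroup = solve-∀

-- Adding a multiple of m to n does not change gcd m n; this identifies the
-- gcd of the statement, with K = k² - 1, with gcd d (k * d + K).
gcd-shift : ∀ m n c → gcd m (c * m + n) ≡ gcd m n
gcd-shift m n c = ∣-antisym
  (gcd-greatest (gcd[m,n]∣m m _)
    (∣m+n∣m⇒∣n (gcd[m,n]∣n m _) (∣n⇒∣m*n c (gcd[m,n]∣m m _))))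
  (gcd-greatest (gcd[m,n]∣m m n)
    (∣m∣n⇒∣m+n (∣n⇒∣m*n c (gcd[m,n]∣m m n)) (gcd[m,n]∣n m n)))

cofactors-coprime : ∀ {m n m′ n′} → gcd m n ≢ 0 →
  m ≡ m′ * gcd m n → n ≡ n′ * gcd m n → Coprime m′ n′
cofactors-coprime {m} {n} {m′} {n′} e≢0 m≡m′e n≡n′e =
  gcd≡1⇒coprime (*-cancelˡ-≡ (gcd m′ n′) 1 e {{≢-nonZero e≢0}} (begin
    e * gcd m′ n′           ≡⟨ c*gcd[m,n]≡gcd[cm,cn] e m′ n′ ⟩
    gcd (e * m′) (e * n′)   ≡⟨ cong₂ gcd (trans (*-comm e m′) (sym m≡m′e))
                                         (trans (*-comm e n′) (sym n≡n′e)) ⟩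
    gcd m n                 ≡⟨ *-identityʳ e ⟨
    e * 1                   ∎))
  where
  open ≡-Reasoning
  e = gcd m n

-- The key inequality: if k * g = 1 + M * e with M < g and k ≥ 2, then
-- k < e.  Otherwise e ≤ k would give k * (M + 1) ≤ k * g ≤ 1 + k * M.
cofactor-bound : ∀ {k g M e} → 2 ≤ k → k * g ≡ suc (M * e) → M < g → k < e
cofactor-bound {k} {g} {M} {e} 2≤k kg≡1+Me M<g =
  ≰⇒> (λ e≤k → <⇒≱ 2≤k (k≤1 e≤k))
  where
  open ≤-Reasoning
  k≤1 : e ≤ k → k ≤ 1
  k≤1 e≤k = +-cancelʳ-≤ (k * M) k 1 (begin
    k + k * M     ≡⟨ *-suc k M ⟨
    k * suc M     ≤⟨ *-monoʳ-≤ k M<g ⟩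
    k * g         ≡⟨ kg≡1+Me ⟩
    suc (M * e)   ≤⟨ s≤s (*-monoʳ-≤ M e≤k) ⟩
    suc (M * k)   ≡⟨ cong suc (*-comm M k) ⟩
    1 + k * M     ∎)

-- (⇒) A solution of b * d = a * L with digits a ≠ 0, b < g forces
-- k < gcd d L: the cofactor M = L / gcd d L is coprime to d / gcd d L and
-- divides b * (d / gcd d L), hence divides b ≠ 0, so M ≤ b < g.
relation⇒k<gcd : ∀ {g k d L a b} → 2 ≤ k → k * g ≡ suc L →
  a ≢ 0 → b < g → b * d ≡ a * L → k < gcd d L
relation⇒k<gcd {g} {k} {d} {L} {a} {b} 2≤k kg≡1+L a≢0 b<g bd≡aL
  with gcd[m,n]∣m d L | gcd[m,n]∣n d L
... | divides d′ d≡d′e | divides M L≡Me =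
  cofactor-bound 2≤k (trans kg≡1+L (cong suc L≡Me)) (≤-<-trans M≤b b<g)
  where
  open ≡-Reasoning
  e = gcd d L
  L≢0 : L ≢ 0
  L≢0 L≡0 = <⇒≢ 2≤k (sym (m*n≡1⇒m≡1 k g (trans kg≡1+L (cong suc L≡0))))
  e≢0 : e ≢ 0
  e≢0 e≡0 = L≢0 (gcd[m,n]≡0⇒n≡0 d e≡0)
  b≢0 : b ≢ 0
  b≢0 b≡0 with m*n≡0⇒m≡0∨n≡0 a (trans (sym bd≡aL) (cong (_* d) b≡0))
  ... | inj₁ a≡0 = a≢0 a≡0
  ... | inj₂ L≡0 = L≢0 L≡0
  d′b≡aM : d′ * b ≡ a * M
  d′b≡aM = *-cancelʳ-≡ _ _ e {{≢-nonZero e≢0}} (begin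
    d′ * b * e   ≡⟨ swap-last d′ b e ⟩
    b * (d′ * e) ≡⟨ cong (b *_) d≡d′e ⟨
    b * d        ≡⟨ bd≡aL ⟩
    a * L        ≡⟨ cong (a *_) L≡Me ⟩
    a * (M * e)  ≡⟨ *-assoc a M e ⟨
    a * M * e    ∎)
    where
    swap-last : ∀ x y z → x * y * z ≡ y * (x * z)
    swap-last = solve-∀
  M∣b : M ∣ b
  M∣b = coprime-divisor (Coprime.sym (cofactors-coprime {m′ = d′} {n′ = M} e≢0 d≡d′e L≡Me))
                        (divides a d′b≡aM)
  M≤b : M ≤ b
  M≤b = ∣⇒≤ {{≢-nonZero b≢0}} M∣b

k<gcd⇒reverse-multiple : ∀ {g k d L} → 0 < k → 0 < d → g ≡ k + d →
  k * g ≡ suc L → k < gcd d L →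
  Σ (Vec ℕ 2) (λ ds → IsReverseMultiple g k 1 ds)
k<gcd⇒reverse-multiple {g} {k} {d} {L} 0<k 0<d g≡k+d kg≡1+L k<e
  with gcd[m,n]∣m d L | gcd[m,n]∣n d L
... | divides d′ d≡d′e | divides M L≡Me =
  (d′ ∷ M ∷ []) , (d′<g ∷ M<g ∷ []) , d′≢0 ,
  Equivalence.from (reverse-relation d′ M g≡k+d kg≡1+L) Md≡d′L
  where
  e = gcd d L
  0<e : 0 < e
  0<e = ≤-<-trans z≤n k<e
  d′≢0 : d′ ≢ 0
  d′≢0 d′≡0 = <⇒≢ 0<d (sym (trans d≡d′e (cong (_* e) d′≡0)))
  d′<g : d′ < g
  d′<g = begin-strict
    d′      ≤⟨ m≤m*n d′ e {{>-nonZero 0<e}} ⟩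
    d′ * e  ≡⟨ d≡d′e ⟨
    d       <⟨ m<n+m d 0<k ⟩
    k + d   ≡⟨ g≡k+d ⟨
    g       ∎
    where open ≤-Reasoning
  M<g : M < g
  M<g = *-cancelʳ-< e M g (begin-strict
    M * e   ≡⟨ L≡Me ⟨
    L       <⟨ n<1+n L ⟩
    suc L   ≡⟨ kg≡1+L ⟨
    k * g   ≤⟨ *-monoˡ-≤ g (<⇒≤ k<e) ⟩
    e * g   ≡⟨ *-comm e g ⟩
    g * e   ∎)
    where open ≤-Reasoning
  Md≡d′L : M * d ≡ d′ * L
  Md≡d′L = begin
    M * d         ≡⟨ cong (M *_) d≡d′e ⟩
    M * (d′ * e)  ≡⟨ exchange M d′ e ⟩
    d′ * (M * e)  ≡⟨ cong (d′ *_) L≡Me ⟨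
    d′ * L        ∎
    where
    open ≡-Reasoning
    exchange : ∀ x y z → x * (y * z) ≡ y * (x * z)
    exchange = solve-∀

proposition3 : (g k : ℕ) → 2 ≤ k → k < g →
    (Σ (Vec ℕ 2) (λ ds → IsReverseMultiple g k 1 ds)) ⇔ (k + 1 ≤ gcd (g ∸ k) (k * k ∸ 1))
proposition3 g k 2≤k k<g =
  subst (Σ (Vec ℕ 2) (λ ds → IsReverseMultiple g k 1 ds) ⇔_) threshold
    (mk⇔ (λ { ((a ∷ b ∷ []) , (_ ∷ b<g ∷ []) , a≢0 , reversed) →
              relation⇒k<gcd {d = d} 2≤k kg≡1+L a≢0 b<g
                (Equivalence.to (reverse-relation a b g≡k+d kg≡1+L) reversed) })
         (k<gcd⇒reverse-multiple {d = d} 0<k (m<n⇒0<n∸m k<g) g≡k+d kg≡1+L))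
  where
  open ≡-Reasoning
  d = g ∸ k
  K = k * k ∸ 1
  L = k * d + K
  0<k : 0 < k
  0<k = <-trans (s≤s z≤n) 2≤k
  g≡k+d : g ≡ k + d
  g≡k+d = sym (m+[n∸m]≡n (<⇒≤ k<g))
  kk≡1+K : k * k ≡ suc K
  kk≡1+K = sym (m+[n∸m]≡n (*-mono-≤ 0<k 0<k))
  kg≡1+L : k * g ≡ suc L
  kg≡1+L = begin
    k * g           ≡⟨ cong (k *_) g≡k+d ⟩
    k * (k + d)     ≡⟨ *-distribˡ-+ k k d ⟩
    k * k + k * d   ≡⟨ cong (_+ k * d) kk≡1+K ⟩
    suc K + k * d   ≡⟨ cong suc (+-comm K (k * d)) ⟩
    suc L           ∎
  threshold : (k < gcd d L) ≡ (k + 1 ≤ gcd d K)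
  threshold = cong₂ _≤_ (+-comm 1 k) (gcd-shift d K k)
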